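{- Let $(T,\prec)$ be a nonempty set with a binary relation, let $(B_i,C_i)$, $i\in T$, be contact algebras, and let $\mathbf{B}$ be a Boolean subalgebra of the product $\prod_{i\in T}B_i$ (operations coordinatewise) which is rich, i.e. contains every $a=\langle a_i\rangle_{i\in T}$ with $a_i\in\{0_i,1_i\}$ for all $i$. Define on $\mathbf{B}$: $aC^sb$ iff $\exists m\in T\,(a_mC_mb_m)$; $aC^tb$ iff $\exists m\in T\,(a_m\neq0_m$ and $b_m\neq0_m)$; $a\mathcal{B}b$ iff $\exists m,n\in T\,(m\prec n$, $a_m\neq0_m$ and $b_n\neq0_n)$. Then: (i) $C^s$ is a contact relation on $\mathbf{B}$; (ii) $C^t$ is a contact relation on $\mathbf{B}$ satisfying $aC^sb\Rightarrow aC^tb$, and: if $a\overline{C^t}b$ then there is $c\in\mathbf{B}$ with $a\overline{C^t}c$ and $c^*\overline{C^t}b$; (iii) $\mathcal{B}$ is a precontact relation on $\mathbf{B}$ satisfying: if $a\overline{\mathcal{B}}b$ then there is $c\in\mathbf{B}$ with $a\overline{C^t}c$ and $c^*\overline{\mathcal{B}}b$; and if $a\overline{\mathcal{B}}b$ then there is $c\in\mathbf{B}$ with $a\overline{\mathcal{B}}c$ and $c^*\overline{C^t}b$.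
   Context: A precontact relation on a Boolean algebra $(B,0,1,\le,+,\cdot,{}^*)$ is a binary relation $C$ such that: $aCb$ implies $a\neq0$ and $b\neq0$; $aCb$, $a\le a'$, $b\le b'$ imply $a'Cb'$; $aC(b+c)$ implies $aCb$ or $aCc$; $(a+b)Cc$ implies $aCc$ or $bCc$. A contact relation is a precontact relation that is symmetric and satisfies $a\cdot b\neq0\Rightarrow aCb$. A contact algebra is a Boolean algebra with a contact relation. $\overline{C}$ denotes the complement of a relation $C$. -}

module Defs where

open import Level using (Level; _⊔_)
open import Data.Product using (Σ; ∃; ∃₂; _×_; _,_; proj₁)
open import Data.Sum using (_⊎_)
open import Relation.Nullary using (¬_)
open import Relation.Binary using (Rel)
open import Relation.Binary.PropositionalEquality using (_≡_)
open import Relation.Unary using (Pred)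
open import Algebra.Core using (Op₁; Op₂)
open import Algebra.Lattice.Bundles using (BooleanAlgebra)

module _ {c ℓ r : Level} {A : Set c} (_≈_ : Rel A ℓ) (_∨_ _∧_ : Op₂ A) (⊥ : A)
         (C : Rel A r) where

  private
    _≤_ : Rel A ℓ
    a ≤ b = (a ∧ b) ≈ a

  record IsPrecontactOn : Set (c ⊔ ℓ ⊔ r) where
    field
      nonzero : ∀ {a b} → C a b → ¬ (a ≈ ⊥) × ¬ (b ≈ ⊥)
      mono    : ∀ {a a′ b b′} → C a b → a ≤ a′ → b ≤ b′ → C a′ b′
      splitʳ  : ∀ {a b d} → C a (b ∨ d) → C a b ⊎ C a d
      splitˡ  : ∀ {a b d} → C (a ∨ b) d → C a d ⊎ C b d

  record IsContactOn : Set (c ⊔ ℓ ⊔ r) where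
    field
      isPrecontact : IsPrecontactOn
      symmetric    : ∀ {a b} → C a b → C b a
      meet⇒C       : ∀ {a b} → ¬ ((a ∧ b) ≈ ⊥) → C a b

IsContact : ∀ {c ℓ r} (B : BooleanAlgebra c ℓ) → Rel (BooleanAlgebra.Carrier B) r → Set (c ⊔ ℓ ⊔ r)
IsContact B C = IsContactOn _≈_ _∨_ _∧_ ⊥ C
  where open BooleanAlgebra B

module Product {t c ℓ : Level} {T : Set t} (Bs : T → BooleanAlgebra c ℓ) where
  module BA = BooleanAlgebra
  open BooleanAlgebra using (Carrier)

  Π : Set (t ⊔ c)
  Π = (i : T) → Carrier (Bs i)

  record IsRichSubalgebra {p : Level} (P : Pred Π p) : Set (t ⊔ c ⊔ p) where
    field
      ∨-closed : ∀ {a b} → P a → P b → P (λ i → BA._∨_ (Bs i) (a i) (b i))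
      ∧-closed : ∀ {a b} → P a → P b → P (λ i → BA._∧_ (Bs i) (a i) (b i))
      ¬-closed : ∀ {a} → P a → P (λ i → BA.¬_ (Bs i) (a i))
      ⊤-closed : P (λ i → BA.⊤ (Bs i))
      ⊥-closed : P (λ i → BA.⊥ (Bs i))
      rich     : ∀ (a : Π) → (∀ i → (a i ≡ BA.⊥ (Bs i)) ⊎ (a i ≡ BA.⊤ (Bs i))) → P a

  module Sub {p : Level} (P : Pred Π p) (S : IsRichSubalgebra P) where
    open IsRichSubalgebra S

    𝐁 : Set (t ⊔ c ⊔ p)
    𝐁 = Σ Π P

    _≈ˢ_ : Rel 𝐁 (t ⊔ ℓ)
    (a , _) ≈ˢ (b , _) = ∀ i → BA._≈_ (Bs i) (a i) (b i)

    _∨ˢ_ : Op₂ 𝐁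
    (a , pa) ∨ˢ (b , pb) = (λ i → BA._∨_ (Bs i) (a i) (b i)) , ∨-closed pa pb

    _∧ˢ_ : Op₂ 𝐁
    (a , pa) ∧ˢ (b , pb) = (λ i → BA._∧_ (Bs i) (a i) (b i)) , ∧-closed pa pb

    ¬ˢ_ : Op₁ 𝐁
    ¬ˢ (a , pa) = (λ i → BA.¬_ (Bs i) (a i)) , ¬-closed pa

    ⊤ˢ ⊥ˢ : 𝐁
    ⊤ˢ = (λ i → BA.⊤ (Bs i)) , ⊤-closed
    ⊥ˢ = (λ i → BA.⊥ (Bs i)) , ⊥-closed

    NZ : 𝐁 → T → Set ℓ
    NZ a m = ¬ (BA._≈_ (Bs m) (proj₁ a m) (BA.⊥ (Bs m)))

    Cˢ : ∀ {r} → ((i : T) → Rel (Carrier (Bs i)) r) → Rel 𝐁 (t ⊔ r)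
    Cˢ Cs a b = ∃ λ m → Cs m (proj₁ a m) (proj₁ b m)

    Cᵗ : Rel 𝐁 (t ⊔ ℓ)
    Cᵗ a b = ∃ λ m → NZ a m × NZ b m

    𝓑 : ∀ {q} → Rel T q → Rel 𝐁 (t ⊔ ℓ ⊔ q)
    𝓑 _≺_ a b = ∃₂ λ m n → m ≺ n × NZ a m × NZ b n

    IsContactˢ : ∀ {r} → Rel 𝐁 r → Set (t ⊔ c ⊔ ℓ ⊔ p ⊔ r)
    IsContactˢ = IsContactOn _≈ˢ_ _∨ˢ_ _∧ˢ_ ⊥ˢ

    IsPrecontactˢ : ∀ {r} → Rel 𝐁 r → Set (t ⊔ c ⊔ ℓ ⊔ p ⊔ r)
    IsPrecontactˢ = IsPrecontactOn _≈ˢ_ _∨ˢ_ _∧ˢ_ ⊥ˢ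

-- The three relations only look at which coordinates are nonzero, so every
-- axiom except the meet axiom is checked in a single coordinate, using that
-- the nonzero elements of a Boolean algebra are upward closed and that a join
-- is nonzero only if one of its arguments is.  The meet axiom needs excluded
-- middle to turn a ∧ b ≠ 0 into a coordinate m with a_m ∧ b_m ≠ 0.  For the
-- separation properties, richness supplies the element zeros a that is 1
-- exactly on the coordinates where a vanishes: it is disjoint from a, and its
-- complement is supported inside the support of a.
module Submission where

open import Defs
open import Level using (Level; _⊔_; lift; lower)
open import Data.Empty using (⊥-elim)
open import Data.Product using (∃; _×_; _,_; map; map₂)
open import Data.Sum using (_⊎_; inj₁; inj₂)
import Data.Sum as Sum
open import Relation.Nullary using (¬_; Dec; yes; no)
open import Relation.Nullary.Decidable using (map′)
open import Relation.Binary using (Rel)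
open import Relation.Binary.PropositionalEquality using (_≡_) renaming (refl to ≡-refl)
open import Relation.Unary using (Pred)
open import Algebra.Lattice.Bundles using (BooleanAlgebra)
open import Axiom.ExcludedMiddle using (ExcludedMiddle)
open import Axiom.DoubleNegationElimination using (em⇒dne)

ExcludedMiddle-lower : ∀ {a b} → ExcludedMiddle (a ⊔ b) → ExcludedMiddle a
ExcludedMiddle-lower {b = b} em = map′ lower lift (em {Level.Lift b _})

module Nonzero {c ℓ} (B : BooleanAlgebra c ℓ) where
  open BooleanAlgebra B renaming (¬_ to ∁_)
  open import Algebra.Lattice.Properties.BooleanAlgebra B
    using (∧-zeroˡ; ∧-zeroʳ; ∨-identityʳ; ¬⊤≈⊥; ¬-involutive)

  ∧-≈⊥ˡ : ∀ {x} y → x ≈ ⊥ → (x ∧ y) ≈ ⊥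
  ∧-≈⊥ˡ y x≈⊥ = trans (∧-cong x≈⊥ refl) (∧-zeroˡ y)

  ∧-≈⊥ʳ : ∀ x {y} → y ≈ ⊥ → (x ∧ y) ≈ ⊥
  ∧-≈⊥ʳ x y≈⊥ = trans (∧-cong refl y≈⊥) (∧-zeroʳ x)

  ∨-≈⊥ : ∀ {x y} → x ≈ ⊥ → y ≈ ⊥ → (x ∨ y) ≈ ⊥
  ∨-≈⊥ x≈⊥ y≈⊥ = trans (∨-cong x≈⊥ y≈⊥) (∨-identityʳ ⊥)

  ≉⊥-mono : ∀ {x y} → (x ∧ y) ≈ x → ¬ x ≈ ⊥ → ¬ y ≈ ⊥
  ≉⊥-mono {x} x≤y x≉⊥ y≈⊥ = x≉⊥ (trans (sym x≤y) (∧-≈⊥ʳ x y≈⊥))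

  ∧-≉⊥ : ∀ {x y} → ¬ (x ∧ y) ≈ ⊥ → ¬ x ≈ ⊥ × ¬ y ≈ ⊥
  ∧-≉⊥ {x} {y} x∧y≉⊥ = (λ x≈⊥ → x∧y≉⊥ (∧-≈⊥ˡ y x≈⊥)) , (λ y≈⊥ → x∧y≉⊥ (∧-≈⊥ʳ x y≈⊥))

  ∨-≉⊥ : ∀ {x y} → Dec (x ≈ ⊥) → ¬ (x ∨ y) ≈ ⊥ → ¬ x ≈ ⊥ ⊎ ¬ y ≈ ⊥
  ∨-≉⊥ (no x≉⊥)  _        = inj₁ x≉⊥
  ∨-≉⊥ (yes x≈⊥) x∨y≉⊥   = inj₂ (λ y≈⊥ → x∨y≉⊥ (∨-≈⊥ x≈⊥ y≈⊥))

  ¬¬-≉⊥ : ∀ {x} → ¬ (∁ ∁ x) ≈ ⊥ → ¬ x ≈ ⊥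
  ¬¬-≉⊥ {x} h x≈⊥ = h (trans (¬-involutive x) x≈⊥)

  indicator : ∀ {a} {X : Set a} → Dec X → Carrier
  indicator (yes _) = ⊤
  indicator (no _)  = ⊥

  indicator-⊥⊤ : ∀ {a} {X : Set a} (d : Dec X) → indicator d ≡ ⊥ ⊎ indicator d ≡ ⊤
  indicator-⊥⊤ (yes _) = inj₂ ≡-refl
  indicator-⊥⊤ (no _)  = inj₁ ≡-refl

  indicator-≉⊥ : ∀ {a} {X : Set a} (d : Dec X) → ¬ indicator d ≈ ⊥ → X
  indicator-≉⊥ (yes x) _  = x
  indicator-≉⊥ (no _)  h  = ⊥-elim (h refl)

  ¬indicator-≉⊥ : ∀ {a} {X : Set a} (d : Dec X) → ¬ (∁ indicator d) ≈ ⊥ → ¬ X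
  ¬indicator-≉⊥ (yes _)  h = ⊥-elim (h ¬⊤≈⊥)
  ¬indicator-≉⊥ (no ¬x)  _ = ¬x

module RichProduct {t c ℓ p : Level} (em : ExcludedMiddle (t ⊔ ℓ))
                   {T : Set t} (Bs : T → BooleanAlgebra c ℓ)
                   (P : Pred (Product.Π Bs) p) (S : Product.IsRichSubalgebra Bs P) where
  open Product.Sub Bs P S
  open Product.IsRichSubalgebra S using (rich)
  module B i = BooleanAlgebra (Bs i)
  module N i = Nonzero (Bs i)

  emℓ : ExcludedMiddle ℓ
  emℓ = ExcludedMiddle-lower {b = t} em

  NZ⇒≉⊥ : ∀ a {m} → NZ a m → ¬ a ≈ˢ ⊥ˢ
  NZ⇒≉⊥ _ {m} nz a≈⊥ = nz (a≈⊥ m)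

  ≉⊥⇒NZ : ∀ a → ¬ a ≈ˢ ⊥ˢ → ∃ (NZ a)
  ≉⊥⇒NZ _ a≉⊥ = em⇒dne em λ noNZ → a≉⊥ λ i → em⇒dne emℓ λ nz → noNZ (i , nz)

  NZ-mono : ∀ a a′ {m} → (a ∧ˢ a′) ≈ˢ a → NZ a m → NZ a′ m
  NZ-mono _ _ {m} a≤a′ = N.≉⊥-mono m (a≤a′ m)

  NZ-∨ : ∀ a b {m} → NZ (a ∨ˢ b) m → NZ a m ⊎ NZ b m
  NZ-∨ _ _ {m} = N.∨-≉⊥ m emℓ

  ≉⊥-∧⇒NZ : ∀ a b → ¬ (a ∧ˢ b) ≈ˢ ⊥ˢ → ∃ λ m → NZ a m × NZ b m
  ≉⊥-∧⇒NZ a b a∧b≉⊥ = map₂ (N.∧-≉⊥ _) (≉⊥⇒NZ (a ∧ˢ b) a∧b≉⊥)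

  zeros : 𝐁 → 𝐁
  zeros (a , _) = (λ i → N.indicator i (emℓ {B._≈_ i (a i) (B.⊥ i)}))
                , rich _ (λ i → N.indicator-⊥⊤ i emℓ)

  NZ-zeros⇒¬NZ : ∀ a {m} → NZ (zeros a) m → ¬ NZ a m
  NZ-zeros⇒¬NZ _ {m} nz ¬nz = ¬nz (N.indicator-≉⊥ m emℓ nz)

  NZ-¬zeros⇒NZ : ∀ a {m} → NZ (¬ˢ zeros a) m → NZ a m
  NZ-¬zeros⇒NZ _ {m} = N.¬indicator-≉⊥ m emℓ

  Cˢ-isContact : ∀ {r} {Cs : (i : T) → Rel (B.Carrier i) r} →
                 (∀ i → IsContact (Bs i) (Cs i)) → IsContactˢ (Cˢ Cs)
  Cˢ-isContact isC = record
    { isPrecontact = record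
      { nonzero = λ { {a} {b} (m , aCb) → map (NZ⇒≉⊥ a) (NZ⇒≉⊥ b) (Pre.nonzero m aCb) }
      ; mono    = λ { (m , aCb) a≤a′ b≤b′ → m , Pre.mono m aCb (a≤a′ m) (b≤b′ m) }
      ; splitʳ  = λ { (m , aCb) → Sum.map (m ,_) (m ,_) (Pre.splitʳ m aCb) }
      ; splitˡ  = λ { (m , aCb) → Sum.map (m ,_) (m ,_) (Pre.splitˡ m aCb) }
      }
    ; symmetric = λ { (m , aCb) → m , Con.symmetric m aCb }
    ; meet⇒C    = λ {a} {b} a∧b≉⊥ → map₂ (Con.meet⇒C _) (≉⊥⇒NZ (a ∧ˢ b) a∧b≉⊥)
    }
    where
    module Con i = IsContactOn (isC i)
    module Pre i = IsPrecontactOn (Con.isPrecontact i)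

  Cᵗ-isContact : IsContactˢ Cᵗ
  Cᵗ-isContact = record
    { isPrecontact = record
      { nonzero = λ { {a} {b} (m , a≠0 , b≠0) → NZ⇒≉⊥ a a≠0 , NZ⇒≉⊥ b b≠0 }
      ; mono    = λ { {a} {a′} {b} {b′} (m , a≠0 , b≠0) a≤a′ b≤b′ →
                      m , NZ-mono a a′ a≤a′ a≠0 , NZ-mono b b′ b≤b′ b≠0 }
      ; splitʳ  = λ { {a} {b} {d} (m , a≠0 , b∨d≠0) →
                      Sum.map (λ h → m , a≠0 , h) (λ h → m , a≠0 , h) (NZ-∨ b d b∨d≠0) }
      ; splitˡ  = λ { {a} {b} {d} (m , a∨b≠0 , d≠0) →
                      Sum.map (λ h → m , h , d≠0) (λ h → m , h , d≠0) (NZ-∨ a b a∨b≠0) }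
      }
    ; symmetric = λ { (m , a≠0 , b≠0) → m , b≠0 , a≠0 }
    ; meet⇒C    = λ {a} {b} → ≉⊥-∧⇒NZ a b
    }

  Cˢ⇒Cᵗ : ∀ {r} {Cs : (i : T) → Rel (B.Carrier i) r} → (∀ i → IsContact (Bs i) (Cs i)) →
          ∀ a b → Cˢ Cs a b → Cᵗ a b
  Cˢ⇒Cᵗ isC _ _ (m , aCb) = m , IsPrecontactOn.nonzero (IsContactOn.isPrecontact (isC m)) aCb

  ¬Cᵗ-separation : ∀ a b → ¬ Cᵗ a b → ∃ λ d → ¬ Cᵗ a d × ¬ Cᵗ (¬ˢ d) b
  ¬Cᵗ-separation a b ¬aCb =
      zeros a
    , (λ { (m , a≠0 , d≠0) → NZ-zeros⇒¬NZ a d≠0 a≠0 })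
    , (λ { (m , d*≠0 , b≠0) → ¬aCb (m , NZ-¬zeros⇒NZ a d*≠0 , b≠0) })

  module _ {q} (_≺_ : Rel T q) where

    𝓑-isPrecontact : IsPrecontactˢ (𝓑 _≺_)
    𝓑-isPrecontact = record
      { nonzero = λ { {a} {b} (m , n , _ , a≠0 , b≠0) → NZ⇒≉⊥ a a≠0 , NZ⇒≉⊥ b b≠0 }
      ; mono    = λ { {a} {a′} {b} {b′} (m , n , m≺n , a≠0 , b≠0) a≤a′ b≤b′ →
                      m , n , m≺n , NZ-mono a a′ a≤a′ a≠0 , NZ-mono b b′ b≤b′ b≠0 }
      ; splitʳ  = λ { {a} {b} {d} (m , n , m≺n , a≠0 , b∨d≠0) →
                      Sum.map (λ h → m , n , m≺n , a≠0 , h) (λ h → m , n , m≺n , a≠0 , h) (NZ-∨ b d b∨d≠0) }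
      ; splitˡ  = λ { {a} {b} {d} (m , n , m≺n , a∨b≠0 , d≠0) →
                      Sum.map (λ h → m , n , m≺n , h , d≠0) (λ h → m , n , m≺n , h , d≠0) (NZ-∨ a b a∨b≠0) }
      }

    ¬𝓑-separationˡ : ∀ a b → ¬ 𝓑 _≺_ a b → ∃ λ d → ¬ Cᵗ a d × ¬ 𝓑 _≺_ (¬ˢ d) b
    ¬𝓑-separationˡ a b ¬a𝓑b =
        zeros a
      , (λ { (m , a≠0 , d≠0) → NZ-zeros⇒¬NZ a d≠0 a≠0 })
      , (λ { (m , n , m≺n , d*≠0 , b≠0) → ¬a𝓑b (m , n , m≺n , NZ-¬zeros⇒NZ a d*≠0 , b≠0) })

    ¬𝓑-separationʳ : ∀ a b → ¬ 𝓑 _≺_ a b → ∃ λ d → ¬ 𝓑 _≺_ a d × ¬ Cᵗ (¬ˢ d) b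
    ¬𝓑-separationʳ a b ¬a𝓑b =
        ¬ˢ zeros b
      , (λ { (m , n , m≺n , a≠0 , d≠0) → ¬a𝓑b (m , n , m≺n , a≠0 , NZ-¬zeros⇒NZ b d≠0) })
      , (λ { (m , d*≠0 , b≠0) → NZ-zeros⇒¬NZ b (N.¬¬-≉⊥ m d*≠0) b≠0 })

lemma3p3 : ∀ {t q c ℓ r p : Level}
    → ExcludedMiddle (t ⊔ q ⊔ c ⊔ ℓ ⊔ r ⊔ p)
    → (T : Set t) (_≺_ : Rel T q) → T
    → (Bs : T → BooleanAlgebra c ℓ)
    → (Cs : (i : T) → Rel (BooleanAlgebra.Carrier (Bs i)) r)
    → (∀ i → IsContact (Bs i) (Cs i))
    → (P : Pred (Product.Π Bs) p) (S : Product.IsRichSubalgebra Bs P)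
    → let open Product.Sub Bs P S in
      IsContactˢ (Cˢ Cs)
      × (IsContactˢ Cᵗ
         × (∀ a b → Cˢ Cs a b → Cᵗ a b)
         × (∀ a b → ¬ Cᵗ a b → ∃ λ d → ¬ Cᵗ a d × ¬ Cᵗ (¬ˢ d) b))
      × (IsPrecontactˢ (𝓑 _≺_)
         × (∀ a b → ¬ 𝓑 _≺_ a b → ∃ λ d → ¬ Cᵗ a d × ¬ 𝓑 _≺_ (¬ˢ d) b)
         × (∀ a b → ¬ 𝓑 _≺_ a b → ∃ λ d → ¬ 𝓑 _≺_ a d × ¬ Cᵗ (¬ˢ d) b))
lemma3p3 {q = q} {c} {r = r} {p} em _ _≺_ _ Bs Cs isC P S =
    Cˢ-isContact isC
  , (Cᵗ-isContact , Cˢ⇒Cᵗ isC , ¬Cᵗ-separation)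
  , (𝓑-isPrecontact _≺_ , ¬𝓑-separationˡ _≺_ , ¬𝓑-separationʳ _≺_)
  where open RichProduct (ExcludedMiddle-lower {b = q ⊔ c ⊔ r ⊔ p} em) Bs P S
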